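{- Let $X\in\{\mathrm{K4\times S5},\mathrm{S4\times S5},\mathrm{SSL}\}$ and let $\varphi$ be a bimodal formula. Then $\varphi$ is $X$-satisfiable if and only if there exists an $X$-tableau-cloud $\mathcal{F}_0$ with respect to $\varphi$ such that there is some $F\in\mathcal{F}_0$ with $\varphi\in F$ and there exists a partial $X$-tableau for $(\varphi,\mathcal{F}_0)$.
   Context: Bimodal formulas are built from propositional variables (set $AT$) by $\neg$, $\wedge$, $K$, $\Box$. $\mathrm{sf}(\varphi)$ is the set of subformulas of $\varphi$; $\mathcal{L}_\Box$ (resp. $\mathcal{L}_K$) is the set of formulas of the form $\Box\chi$ (resp. $K\chi$). Models: $M=(W,\stackrel{\Diamond}{\to},\stackrel{L}{\to},\sigma)$, $\sigma:AT\to\mathcal{P}(W)$, with the usual semantics ($\Box$ quantifies over $\stackrel{\Diamond}{\to}$-successors, $K$ over $\stackrel{L}{\to}$-successors). Left commutativity: if $w\stackrel{\Diamond}{\to}u\stackrel{L}{\to}u'$ then $w\stackrel{L}{\to}w'\stackrel{\Diamond}{\to}u'$ for some $w'$; right commutativity: if $w\stackrel{L}{\to}w'\stackrel{\Diamond}{\to}u'$ then $w\stackrel{\Diamond}{\to}u\stackrel{L}{\to}u'$ for some $u$. A $\mathrm{K4\times S5}$-model (commutator model) has $\stackrel{\Diamond}{\to}$ transitive, $\stackrel{L}{\to}$ an equivalence, and both commutativities; an $\mathrm{S4\times S5}$-model additionally has $\stackrel{\Diamond}{\to}$ reflexive. An $\mathrm{SSL}$-model (cross axiom model) has $\stackrel{\Diamond}{\to}$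 a preorder, $\stackrel{L}{\to}$ an equivalence, left commutativity, and persistence: $w\stackrel{\Diamond}{\to}v$ implies $(w\in\sigma(A)\iff v\in\sigma(A))$ for $A\in AT$. $\varphi$ is $X$-satisfiable iff it holds at some point of some $X$-model. (For $X\in\{\mathrm{K4\times S5},\mathrm{S4\times S5}\}$ this is equivalent, by a known result, to satisfiability in a product model of a K4- resp. S4-frame with an S5-frame.) Tableau-sets: a $\mathrm{K4\times S5}$-tableau-set w.r.t. $\varphi$ is $F\subseteq\mathrm{sf}(\varphi)$ with, for all $\psi\in\mathrm{sf}(\varphi)$: (a) $\neg\chi\in F\iff\chi\notin F$; (b) $(\chi_1\wedge\chi_2)\in F\iff \chi_1,\chi_2\in F$; (c) $K\chi\in F\Rightarrow\chi\in F$. An $\mathrm{S4\times S5}$- or $\mathrm{SSL}$-tableau-set additionally satisfies (d) $\Box\chi\in F\Rightarrow\chi\in F$. $\mathcal{T}^X_\varphi$ is the set of $X$-tableau-sets. An $X$-tableau-cloud is $\mathcal{F}\subseteq\mathcal{T}^X_\varphi$ with (a) $F\cap\mathcal{L}_K=G\cap\mathcal{L}_K$ for all $F,G\in\mathcal{F}$, and (b) for all $\chi$ with $K\chi\in\mathrm{sf}(\varphi)$, if $\chi\in\bigcap_{F\in\mathcal{F}}F$ then $K\chi\in\bigcap_{F\in\mathcal{F}}F$. $\mathfrak{C}^X_\varphi$ is the set of $X$-tableau-clouds. Relations: for $F,G\in\mathcal{T}^X_\varphi$, $F\preccurlyeq_X G$ means: for $\mathrm{K4\times S5}$, $F\cap\mathcal{L}_\Box\subseteq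 G$ and $\{\psi:\Box\psi\in F\}\subseteq G$; for $\mathrm{S4\times S5}$, $F\cap\mathcal{L}_\Box\subseteq G$; for $\mathrm{SSL}$, $F\cap\mathcal{L}_\Box\subseteq G$ and $F\cap AT=G\cap AT$. For $\mathcal{F},\mathcal{G}\subseteq\mathcal{T}^X_\varphi$, $\mathcal{F}\leq_X\mathcal{G}$ means: for $X\in\{\mathrm{K4\times S5},\mathrm{S4\times S5}\}$, every $G\in\mathcal{G}$ has some $F\in\mathcal{F}$ with $F\preccurlyeq_X G$ and every $F\in\mathcal{F}$ has some $G\in\mathcal{G}$ with $F\preccurlyeq_X G$; for $\mathrm{SSL}$, only the first of these two conditions. Partial tableau: given pairwise different $\mathcal{F}_0,\dots,\mathcal{F}_m\in\mathfrak{C}^X_\varphi$ ($m\geq0$) with $\mathcal{F}_i\leq_X\mathcal{F}_{i+1}$ for $i<m$, a partial $X$-tableau for $(\varphi,\mathcal{F}_0,\dots,\mathcal{F}_m)$ is a set $\mathfrak{T}\subseteq\mathfrak{C}^X_\varphi$ with (1) $\mathcal{F}_i\in\mathfrak{T}$ for all $i\leq m$; (2) for all $\mathcal{F}\in\mathfrak{T}\setminus\{\mathcal{F}_0,\dots,\mathcal{F}_{m-1}\}$, all $F\in\mathcal{F}$ and all $\chi$ with $\Box\chi\in\mathrm{sf}(\varphi)\setminus F$, there are $\mathcal{G}\in\mathfrak{T}$ with $\mathcal{F}\leq_X\mathcal{G}$ and $G\in\mathcal{G}$ with $F\preccurlyeq_X G$ and $\chi\notin G$. -}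

module Defs where

open import Level using (Level; 0ℓ; Setω) renaming (suc to lsuc)
open import Data.Product using (Σ; Σ-syntax; _×_; _,_)
open import Data.Unit using (⊤)
open import Relation.Nullary using (¬_)
open import Function.Bundles using (_⇔_)
open import Axiom.ExcludedMiddle using (ExcludedMiddle)

data Formula (AT : Set) : Set where
  atom : AT → Formula AT
  ¬'_  : Formula AT → Formula AT
  _∧'_ : Formula AT → Formula AT → Formula AT
  K    : Formula AT → Formula AT
  □    : Formula AT → Formula AT

data Sub {AT : Set} (ψ : Formula AT) : Formula AT → Set where
  here  : Sub ψ ψ
  in¬   : ∀ {χ} → Sub ψ χ → Sub ψ (¬' χ)
  in∧ˡ  : ∀ {χ₁ χ₂} → Sub ψ χ₁ → Sub ψ (χ₁ ∧' χ₂)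
  in∧ʳ  : ∀ {χ₁ χ₂} → Sub ψ χ₂ → Sub ψ (χ₁ ∧' χ₂)
  inK   : ∀ {χ} → Sub ψ χ → Sub ψ (K χ)
  in□   : ∀ {χ} → Sub ψ χ → Sub ψ (□ χ)

record Model (AT : Set) : Set₁ where
  field
    W   : Set
    _⟶◇_ : W → W → Set
    _⟶L_ : W → W → Set
    σ   : AT → W → Set

module _ {AT : Set} where
  open Model

  _,_⊨_ : (M : Model AT) → W M → Formula AT → Set
  M , w ⊨ atom A   = σ M A w
  M , w ⊨ (¬' φ)   = ¬ (M , w ⊨ φ)
  M , w ⊨ (φ ∧' ψ) = (M , w ⊨ φ) × (M , w ⊨ ψ)
  M , w ⊨ K φ      = ∀ v → _⟶L_ M w v → M , v ⊨ φ
  M , w ⊨ □ φ      = ∀ v → _⟶◇_ M w v → M , v ⊨ φ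

data Logic : Set where
  K4×S5 S4×S5 SSL : Logic

module _ {AT : Set} (M : Model AT) where
  open Model M

  Reflexive◇ : Set
  Reflexive◇ = ∀ w → w ⟶◇ w
  Transitive◇ : Set
  Transitive◇ = ∀ {u v w} → u ⟶◇ v → v ⟶◇ w → u ⟶◇ w
  EquivalenceL : Set
  EquivalenceL = (∀ w → w ⟶L w)
               × (∀ {u v} → u ⟶L v → v ⟶L u)
               × (∀ {u v w} → u ⟶L v → v ⟶L w → u ⟶L w)
  LeftComm : Set
  LeftComm = ∀ {w u u'} → w ⟶◇ u → u ⟶L u' → Σ[ w' ∈ W ] (w ⟶L w' × w' ⟶◇ u')
  RightComm : Set
  RightComm = ∀ {w w' u'} → w ⟶L w' → w' ⟶◇ u' → Σ[ u ∈ W ] (w ⟶◇ u × u ⟶L u')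
  Persistence : Set
  Persistence = ∀ {w v} → w ⟶◇ v → ∀ A → (σ A w ⇔ σ A v)

  IsModel : Logic → Set
  IsModel K4×S5 = Transitive◇ × EquivalenceL × LeftComm × RightComm
  IsModel S4×S5 = Reflexive◇ × Transitive◇ × EquivalenceL × LeftComm × RightComm
  IsModel SSL   = Reflexive◇ × Transitive◇ × EquivalenceL × LeftComm × Persistence

Satisfiable : {AT : Set} → Logic → Formula AT → Set₁
Satisfiable {AT} X φ =
  Σ[ M ∈ Model AT ] (IsModel M X × Σ[ w ∈ Model.W M ] (M , w ⊨ φ))

FSet : Set → Set₁
FSet AT = Formula AT → Set

BoxT : {AT : Set} → Logic → FSet AT → Set
BoxT K4×S5 F = ⊤
BoxT S4×S5 F = ∀ χ → F (□ χ) → F χ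
BoxT SSL   F = ∀ χ → F (□ χ) → F χ

Prec : {AT : Set} → Logic → FSet AT → FSet AT → Set
Prec K4×S5 F G = (∀ χ → F (□ χ) → G (□ χ)) × (∀ ψ → F (□ ψ) → G ψ)
Prec S4×S5 F G = ∀ χ → F (□ χ) → G (□ χ)
Prec SSL   F G = (∀ χ → F (□ χ) → G (□ χ)) × (∀ A → (F (atom A) ⇔ G (atom A)))

Leq : {AT : Set} → Logic → (FSet AT → Set) → (FSet AT → Set) → Set₁
Leq {AT} K4×S5 𝓕 𝓖 = (∀ G → 𝓖 G → Σ[ F ∈ FSet AT ] (𝓕 F × Prec K4×S5 F G))
                   × (∀ F → 𝓕 F → Σ[ G ∈ FSet AT ] (𝓖 G × Prec K4×S5 F G))
Leq {AT} S4×S5 𝓕 𝓖 = (∀ G → 𝓖 G → Σ[ F ∈ FSet AT ] (𝓕 F × Prec S4×S5 F G))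
                   × (∀ F → 𝓕 F → Σ[ G ∈ FSet AT ] (𝓖 G × Prec S4×S5 F G))
Leq {AT} SSL   𝓕 𝓖 = ∀ G → 𝓖 G → Σ[ F ∈ FSet AT ] (𝓕 F × Prec SSL F G)

module _ {AT : Set} (X : Logic) (φ : Formula AT) where

  _≼_ : FSet AT → FSet AT → Set
  _≼_ = Prec X

  _≤_ : (FSet AT → Set) → (FSet AT → Set) → Set₁
  _≤_ = Leq X

  IsTableauSet : FSet AT → Set
  IsTableauSet F =
      (∀ ψ → F ψ → Sub ψ φ)
    × (∀ χ → Sub (¬' χ) φ → (F (¬' χ) ⇔ (¬ F χ)))
    × (∀ χ₁ χ₂ → Sub (χ₁ ∧' χ₂) φ → (F (χ₁ ∧' χ₂) ⇔ (F χ₁ × F χ₂)))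
    × (∀ χ → Sub (K χ) φ → F (K χ) → F χ)
    × BoxT X F

  IsCloud : (FSet AT → Set) → Set₁
  IsCloud 𝓕 =
      (∀ F → 𝓕 F → IsTableauSet F)
    × (∀ F G → 𝓕 F → 𝓕 G → ∀ χ → (F (K χ) ⇔ G (K χ)))
    × (∀ χ → Sub (K χ) φ → (∀ F → 𝓕 F → F χ) → ∀ F → 𝓕 F → F (K χ))

  -- Partial X-tableau for (φ, 𝓕₀)  (the case m = 0, so the excluded
  -- list {𝓕₀,…,𝓕_{m-1}} in condition (2) is empty).
  IsPartialTableau₀ : (FSet AT → Set) → ((FSet AT → Set) → Set) → Set₁
  IsPartialTableau₀ 𝓕₀ 𝔗 =
      (∀ 𝓕 → 𝔗 𝓕 → IsCloud 𝓕)
    × 𝔗 𝓕₀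
    × (∀ 𝓕 → 𝔗 𝓕 → ∀ F → 𝓕 F → ∀ χ → Sub (□ χ) φ → ¬ F (□ χ) →
         Σ[ 𝓖 ∈ (FSet AT → Set) ] (𝔗 𝓖 × 𝓕 ≤ 𝓖
           × Σ[ G ∈ FSet AT ] (𝓖 G × F ≼ G × ¬ G χ)))

-- Classical metatheory (the paper reasons classically)
Classical : Setω
Classical = ∀ {ℓ} → ExcludedMiddle ℓ

-- Soundness: in a model, the φ-theories of the worlds in one L-class form a
-- cloud, and the clouds of all L-classes form a partial tableau, since a box
-- missing from a theory is refuted at some ◇-successor, whose L-class is the
-- required ≤-larger cloud.  Completeness: the canonical model has as worlds
-- the pairs (F, 𝓕) with F ∈ 𝓕 ∈ 𝔗, L-related when they share the cloud and
-- ◇-related when 𝓕 ≤ 𝓖 and F ≼ G.  The cloud conditions give the K case of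
-- the truth lemma, the extension condition of the partial tableau gives the
-- □ case, and the two clauses of ≤ give left and right commutativity.

module Submission where

open import Defs
open import Data.Bool using (Bool; T)
open import Data.Product using (Σ-syntax; _×_; _,_; proj₁; proj₂)
open import Data.Product.Function.NonDependent.Propositional using (_×-⇔_)
open import Data.Unit using (tt)
open import Function using (id; _∘_)
open import Function.Bundles using (_⇔_; mk⇔; Equivalence)
import Function.Properties.Equivalence as ⇔
open import Function.Related.TypeIsomorphisms using (¬-cong-⇔)
open import Relation.Nullary using (¬_)
open import Relation.Nullary.Decidable using (isYes; toWitness; fromWitness)
open import Axiom.DoubleNegationElimination using (em⇒dne)
open import Relation.Binary.PropositionalEquality using (_≡_; refl; sym; trans; subst)

open Equivalence using (to; from)

Sub-trans : ∀ {AT} {ψ χ φ : Formula AT} → Sub ψ χ → Sub χ φ → Sub ψ φ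
Sub-trans p here     = p
Sub-trans p (in¬ q)  = in¬ (Sub-trans p q)
Sub-trans p (in∧ˡ q) = in∧ˡ (Sub-trans p q)
Sub-trans p (in∧ʳ q) = in∧ʳ (Sub-trans p q)
Sub-trans p (inK q)  = inK (Sub-trans p q)
Sub-trans p (in□ q)  = in□ (Sub-trans p q)

-- Tableaux and worlds must be small types, but statements about clouds, such
-- as 𝓒 ≋ 𝓖, live in Set₁; excluded middle decides them, and the Boolean
-- answer is a small proxy.
module Resizing (em : Classical) where

  decide : ∀ {ℓ} → Set ℓ → Bool
  decide P = isYes (em {P = P})

  ∥_∥ : ∀ {ℓ} → Set ℓ → Set
  ∥ P ∥ = T (decide P)

  resize : ∀ {ℓ} {P : Set ℓ} → P → ∥ P ∥
  resize = fromWitness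

  unresize : ∀ {ℓ} {P : Set ℓ} → ∥ P ∥ → P
  unresize = toWitness

module _ {AT : Set} where

  infix 4 _≐_ _⊑_ _≋_

  -- Sets of formulas are predicates, so the tableau notions are invariant only
  -- under extensional equality.
  _≐_ : FSet AT → FSet AT → Set
  F ≐ G = ∀ ψ → F ψ ⇔ G ψ

  ≐-refl : ∀ {F} → F ≐ F
  ≐-refl ψ = ⇔.refl

  ≐-sym : ∀ {F G} → F ≐ G → G ≐ F
  ≐-sym F≐G ψ = ⇔.sym (F≐G ψ)

  ≐-trans : ∀ {F G H} → F ≐ G → G ≐ H → F ≐ H
  ≐-trans F≐G G≐H ψ = ⇔.trans (F≐G ψ) (G≐H ψ)

  _⊑_ : (FSet AT → Set) → (FSet AT → Set) → Set₁
  𝓕 ⊑ 𝓖 = ∀ F → 𝓕 F → Σ[ G ∈ FSet AT ] (𝓖 G × F ≐ G)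

  _≋_ : (FSet AT → Set) → (FSet AT → Set) → Set₁
  𝓕 ≋ 𝓖 = 𝓕 ⊑ 𝓖 × 𝓖 ⊑ 𝓕

  ⊑-refl : ∀ {𝓕} → 𝓕 ⊑ 𝓕
  ⊑-refl F F∈𝓕 = F , F∈𝓕 , ≐-refl

  ⊑-trans : ∀ {𝓕 𝓖 𝓗} → 𝓕 ⊑ 𝓖 → 𝓖 ⊑ 𝓗 → 𝓕 ⊑ 𝓗
  ⊑-trans 𝓕⊑𝓖 𝓖⊑𝓗 F F∈𝓕 with 𝓕⊑𝓖 F F∈𝓕
  ... | G , G∈𝓖 , F≐G with 𝓖⊑𝓗 G G∈𝓖
  ... | H , H∈𝓗 , G≐H = H , H∈𝓗 , ≐-trans F≐G G≐H

  ≋-refl : ∀ {𝓕} → 𝓕 ≋ 𝓕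
  ≋-refl = ⊑-refl , ⊑-refl

  ≋-sym : ∀ {𝓕 𝓖} → 𝓕 ≋ 𝓖 → 𝓖 ≋ 𝓕
  ≋-sym (𝓕⊑𝓖 , 𝓖⊑𝓕) = 𝓖⊑𝓕 , 𝓕⊑𝓖

  ≋-trans : ∀ {𝓕 𝓖 𝓗} → 𝓕 ≋ 𝓖 → 𝓖 ≋ 𝓗 → 𝓕 ≋ 𝓗
  ≋-trans (𝓕⊑𝓖 , 𝓖⊑𝓕) (𝓖⊑𝓗 , 𝓗⊑𝓖) = ⊑-trans 𝓕⊑𝓖 𝓖⊑𝓗 , ⊑-trans 𝓗⊑𝓖 𝓖⊑𝓕

  Prec-resp-≐ : ∀ X {F F′ G G′} → F′ ≐ F → G ≐ G′ → Prec {AT} X F G → Prec {AT} X F′ G′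
  Prec-resp-≐ K4×S5 F′≐F G≐G′ (boxes , unboxed) =
    (λ χ → to (G≐G′ (□ χ)) ∘ boxes χ ∘ to (F′≐F (□ χ))) ,
    (λ ψ → to (G≐G′ ψ) ∘ unboxed ψ ∘ to (F′≐F (□ ψ)))
  Prec-resp-≐ S4×S5 F′≐F G≐G′ boxes χ = to (G≐G′ (□ χ)) ∘ boxes χ ∘ to (F′≐F (□ χ))
  Prec-resp-≐ SSL F′≐F G≐G′ (boxes , atoms) =
    (λ χ → to (G≐G′ (□ χ)) ∘ boxes χ ∘ to (F′≐F (□ χ))) ,
    λ A → ⇔.trans (F′≐F (atom A)) (⇔.trans (atoms A) (G≐G′ (atom A)))

  Prec-trans : ∀ X {F G H} → Prec {AT} X F G → Prec {AT} X G H → Prec {AT} X F H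
  Prec-trans K4×S5 (boxes , unboxed) (boxes′ , unboxed′) =
    (λ χ → boxes′ χ ∘ boxes χ) , λ ψ → unboxed′ ψ ∘ boxes ψ
  Prec-trans S4×S5 boxes boxes′ χ = boxes′ χ ∘ boxes χ
  Prec-trans SSL (boxes , atoms) (boxes′ , atoms′) =
    (λ χ → boxes′ χ ∘ boxes χ) , λ A → ⇔.trans (atoms A) (atoms′ A)

  Prec-unbox : ∀ X {F G} χ → Prec {AT} X F G → BoxT {AT} X G → F (□ χ) → G χ
  Prec-unbox K4×S5 χ (_ , unboxed) _ = unboxed χ
  Prec-unbox S4×S5 χ boxes       reflG = reflG χ ∘ boxes χ
  Prec-unbox SSL   χ (boxes , _) reflG = reflG χ ∘ boxes χ

  Back : Logic → (FSet AT → Set) → (FSet AT → Set) → Set₁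
  Back X 𝓕 𝓖 = ∀ G → 𝓖 G → Σ[ F ∈ FSet AT ] (𝓕 F × Prec {AT} X F G)

  Forth : Logic → (FSet AT → Set) → (FSet AT → Set) → Set₁
  Forth X 𝓕 𝓖 = ∀ F → 𝓕 F → Σ[ G ∈ FSet AT ] (𝓖 G × Prec {AT} X F G)

  Back-resp-⊑ : ∀ X {𝓕 𝓕′ 𝓖 𝓖′} → 𝓕 ⊑ 𝓕′ → 𝓖′ ⊑ 𝓖 → Back X 𝓕 𝓖 → Back X 𝓕′ 𝓖′
  Back-resp-⊑ X 𝓕⊑𝓕′ 𝓖′⊑𝓖 back G′ G′∈𝓖′ with 𝓖′⊑𝓖 G′ G′∈𝓖′
  ... | G , G∈𝓖 , G′≐G with back G G∈𝓖
  ... | F , F∈𝓕 , F≼G with 𝓕⊑𝓕′ F F∈𝓕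
  ... | F′ , F′∈𝓕′ , F≐F′ = F′ , F′∈𝓕′ , Prec-resp-≐ X (≐-sym F≐F′) (≐-sym G′≐G) F≼G

  Forth-resp-⊑ : ∀ X {𝓕 𝓕′ 𝓖 𝓖′} → 𝓕′ ⊑ 𝓕 → 𝓖 ⊑ 𝓖′ → Forth X 𝓕 𝓖 → Forth X 𝓕′ 𝓖′
  Forth-resp-⊑ X 𝓕′⊑𝓕 𝓖⊑𝓖′ forth F′ F′∈𝓕′ with 𝓕′⊑𝓕 F′ F′∈𝓕′
  ... | F , F∈𝓕 , F′≐F with forth F F∈𝓕
  ... | G , G∈𝓖 , F≼G with 𝓖⊑𝓖′ G G∈𝓖
  ... | G′ , G′∈𝓖′ , G≐G′ = G′ , G′∈𝓖′ , Prec-resp-≐ X F′≐F G≐G′ F≼G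

  Back-trans : ∀ X {𝓕 𝓖 𝓗} → Back X 𝓕 𝓖 → Back X 𝓖 𝓗 → Back X 𝓕 𝓗
  Back-trans X back back′ H H∈𝓗 with back′ H H∈𝓗
  ... | G , G∈𝓖 , G≼H with back G G∈𝓖
  ... | F , F∈𝓕 , F≼G = F , F∈𝓕 , Prec-trans X F≼G G≼H

  Forth-trans : ∀ X {𝓕 𝓖 𝓗} → Forth X 𝓕 𝓖 → Forth X 𝓖 𝓗 → Forth X 𝓕 𝓗
  Forth-trans X forth forth′ F F∈𝓕 with forth F F∈𝓕
  ... | G , G∈𝓖 , F≼G with forth′ G G∈𝓖
  ... | H , H∈𝓗 , G≼H = H , H∈𝓗 , Prec-trans X F≼G G≼H

  Leq-resp-≋ : ∀ X {𝓕 𝓕′ 𝓖 𝓖′} → 𝓕 ≋ 𝓕′ → 𝓖 ≋ 𝓖′ → Leq {AT} X 𝓕 𝓖 → Leq {AT} X 𝓕′ 𝓖′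
  Leq-resp-≋ K4×S5 (⊑₁ , ⊒₁) (⊑₂ , ⊒₂) (back , forth) =
    Back-resp-⊑ K4×S5 ⊑₁ ⊒₂ back , Forth-resp-⊑ K4×S5 ⊒₁ ⊑₂ forth
  Leq-resp-≋ S4×S5 (⊑₁ , ⊒₁) (⊑₂ , ⊒₂) (back , forth) =
    Back-resp-⊑ S4×S5 ⊑₁ ⊒₂ back , Forth-resp-⊑ S4×S5 ⊒₁ ⊑₂ forth
  Leq-resp-≋ SSL (⊑₁ , _) (_ , ⊒₂) back = Back-resp-⊑ SSL ⊑₁ ⊒₂ back

  Leq-trans : ∀ X {𝓕 𝓖 𝓗} → Leq {AT} X 𝓕 𝓖 → Leq {AT} X 𝓖 𝓗 → Leq {AT} X 𝓕 𝓗
  Leq-trans K4×S5 (back , forth) (back′ , forth′) =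
    Back-trans K4×S5 back back′ , Forth-trans K4×S5 forth forth′
  Leq-trans S4×S5 (back , forth) (back′ , forth′) =
    Back-trans S4×S5 back back′ , Forth-trans S4×S5 forth forth′
  Leq-trans SSL = Back-trans SSL

  Leq-refl : ∀ X → (∀ F → Prec {AT} X F F) → ∀ {𝓕} → Leq {AT} X 𝓕 𝓕
  Leq-refl K4×S5 ≼-refl = (λ F F∈𝓕 → F , F∈𝓕 , ≼-refl F) , (λ F F∈𝓕 → F , F∈𝓕 , ≼-refl F)
  Leq-refl S4×S5 ≼-refl = (λ F F∈𝓕 → F , F∈𝓕 , ≼-refl F) , (λ F F∈𝓕 → F , F∈𝓕 , ≼-refl F)
  Leq-refl SSL   ≼-refl = λ F F∈𝓕 → F , F∈𝓕 , ≼-refl F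

  Leq⇒Back : ∀ X {𝓕 𝓖} → Leq {AT} X 𝓕 𝓖 → Back X 𝓕 𝓖
  Leq⇒Back K4×S5 = proj₁
  Leq⇒Back S4×S5 = proj₁
  Leq⇒Back SSL   = id

  BoxT-resp-≐ : ∀ X {F G} → F ≐ G → BoxT {AT} X F → BoxT {AT} X G
  BoxT-resp-≐ K4×S5 F≐G _     = tt
  BoxT-resp-≐ S4×S5 F≐G reflF χ = to (F≐G χ) ∘ reflF χ ∘ from (F≐G (□ χ))
  BoxT-resp-≐ SSL   F≐G reflF χ = to (F≐G χ) ∘ reflF χ ∘ from (F≐G (□ χ))

  IsTableauSet-resp-≐ : ∀ X φ {F G} → F ≐ G → IsTableauSet X φ F → IsTableauSet X φ G
  IsTableauSet-resp-≐ X φ F≐G (sub , neg , conj , unK , reflF) =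
      (λ ψ → sub ψ ∘ from (F≐G ψ))
    , (λ χ s → ⇔.trans (G≐F (¬' χ)) (⇔.trans (neg χ s) (¬-cong-⇔ (F≐G χ))))
    , (λ χ₁ χ₂ s → ⇔.trans (G≐F (χ₁ ∧' χ₂)) (⇔.trans (conj χ₁ χ₂ s) (F≐G χ₁ ×-⇔ F≐G χ₂)))
    , (λ χ s → to (F≐G χ) ∘ unK χ s ∘ from (F≐G (K χ)))
    , BoxT-resp-≐ X F≐G reflF
    where
    G≐F = ≐-sym F≐G

  IsCloud-resp-≋ : ∀ X φ {𝓕 𝓖} → 𝓕 ≋ 𝓖 → IsCloud X φ 𝓕 → IsCloud X φ 𝓖
  IsCloud-resp-≋ X φ {𝓕} {𝓖} (𝓕⊑𝓖 , 𝓖⊑𝓕) (tableauSets , sameK , closedK) =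
      (λ G G∈𝓖 → IsTableauSet-resp-≐ X φ (≐-sym (copy≐ G∈𝓖)) (tableauSets _ (copy∈ G∈𝓖)))
    , (λ G G′ G∈𝓖 G′∈𝓖 χ →
         ⇔.trans (copy≐ G∈𝓖 (K χ))
           (⇔.trans (sameK _ _ (copy∈ G∈𝓖) (copy∈ G′∈𝓖) χ) (⇔.sym (copy≐ G′∈𝓖 (K χ)))))
    , (λ χ s χ∈𝓖 G G∈𝓖 →
         from (copy≐ G∈𝓖 (K χ))
           (closedK χ s (λ F F∈𝓕 → from (image≐ F∈𝓕 χ) (χ∈𝓖 _ (image∈ F∈𝓕))) _ (copy∈ G∈𝓖)))
    where
    copy∈ : ∀ {G} (G∈𝓖 : 𝓖 G) → 𝓕 (proj₁ (𝓖⊑𝓕 G G∈𝓖))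
    copy∈ G∈𝓖 = proj₁ (proj₂ (𝓖⊑𝓕 _ G∈𝓖))
    copy≐ : ∀ {G} (G∈𝓖 : 𝓖 G) → G ≐ proj₁ (𝓖⊑𝓕 G G∈𝓖)
    copy≐ G∈𝓖 = proj₂ (proj₂ (𝓖⊑𝓕 _ G∈𝓖))
    image∈ : ∀ {F} (F∈𝓕 : 𝓕 F) → 𝓖 (proj₁ (𝓕⊑𝓖 F F∈𝓕))
    image∈ F∈𝓕 = proj₁ (proj₂ (𝓕⊑𝓖 _ F∈𝓕))
    image≐ : ∀ {F} (F∈𝓕 : 𝓕 F) → F ≐ proj₁ (𝓕⊑𝓖 F F∈𝓕)
    image≐ F∈𝓕 = proj₂ (proj₂ (𝓕⊑𝓖 _ F∈𝓕))

  HasPartialTableau : Logic → Formula AT → Set₁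
  HasPartialTableau X φ =
    Σ[ 𝓕₀ ∈ (FSet AT → Set) ] (IsCloud X φ 𝓕₀
      × Σ[ F ∈ FSet AT ] (𝓕₀ F × F φ)
      × Σ[ 𝔗 ∈ ((FSet AT → Set) → Set) ] IsPartialTableau₀ X φ 𝓕₀ 𝔗)

module FromModel (em : Classical) {AT : Set} (φ : Formula AT) (M : Model AT)
                 (L-equivalence : EquivalenceL M) (leftComm : LeftComm M) where
  open Model M
  open Resizing em

  L-refl : ∀ w → w ⟶L w
  L-refl = proj₁ L-equivalence

  L-sym : ∀ {u v} → u ⟶L v → v ⟶L u
  L-sym = proj₁ (proj₂ L-equivalence)

  L-trans : ∀ {u v w} → u ⟶L v → v ⟶L w → u ⟶L w
  L-trans = proj₂ (proj₂ L-equivalence)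

  theory : W → FSet AT
  theory v ψ = Sub ψ φ × M , v ⊨ ψ

  theoryCloud : W → FSet AT → Set
  theoryCloud w F = Σ[ v ∈ W ] (w ⟶L v × F ≐ theory v)

  theory-isTableauSet : ∀ X v → BoxT X (theory v) → IsTableauSet X φ (theory v)
  theory-isTableauSet X v reflT =
      (λ ψ → proj₁)
    , (λ χ s → mk⇔ (λ (_ , ¬χ) (_ , χ) → ¬χ χ)
                   (λ χ∉ → s , λ χ → χ∉ (Sub-trans (in¬ here) s , χ)))
    , (λ χ₁ χ₂ s → mk⇔ (λ (_ , χ₁ , χ₂) → (Sub-trans (in∧ˡ here) s , χ₁)
                                         , (Sub-trans (in∧ʳ here) s , χ₂))
                       (λ ((_ , χ₁) , (_ , χ₂)) → s , χ₁ , χ₂))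
    , (λ χ s (_ , Kχ) → Sub-trans (inK here) s , Kχ v (L-refl v))
    , reflT

  theory-unbox : Reflexive◇ M → ∀ v χ → theory v (□ χ) → theory v χ
  theory-unbox ◇-refl v χ (s , □χ) = Sub-trans (in□ here) s , □χ v (◇-refl v)

  theory-K-invariant : ∀ {v u} → v ⟶L u → ∀ χ → theory v (K χ) ⇔ theory u (K χ)
  theory-K-invariant vu χ =
    mk⇔ (λ (s , Kχ) → s , λ u′ uu′ → Kχ u′ (L-trans vu uu′))
        (λ (s , Kχ) → s , λ v′ vv′ → Kχ v′ (L-trans (L-sym vu) vv′))

  theoryCloud-isCloud : ∀ X → (∀ v → BoxT X (theory v)) → ∀ w → IsCloud X φ (theoryCloud w)
  theoryCloud-isCloud X reflT w =
      (λ F (v , _ , F≐) → IsTableauSet-resp-≐ X φ (≐-sym F≐) (theory-isTableauSet X v (reflT v)))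
    , (λ F G (v , wv , F≐) (u , wu , G≐) χ →
         ⇔.trans (F≐ (K χ)) (⇔.trans (theory-K-invariant (L-trans (L-sym wv) wu) χ) (⇔.sym (G≐ (K χ)))))
    , (λ χ s χ∈all F (v , wv , F≐) →
         from (F≐ (K χ)) (s , λ u vu → proj₂ (χ∈all (theory u) (u , L-trans wv vu , ≐-refl))))

  theoryCloud-resp-L : ∀ {w w′} → w ⟶L w′ → theoryCloud w ≋ theoryCloud w′
  theoryCloud-resp-L ww′ =
      (λ F (v , wv , F≐) → F , (v , L-trans (L-sym ww′) wv , F≐) , ≐-refl)
    , (λ F (v , w′v , F≐) → F , (v , L-trans ww′ w′v , F≐) , ≐-refl)

  ◇⇒Prec-S4×S5 : Transitive◇ M → ∀ {a b} → a ⟶◇ b → Prec S4×S5 (theory a) (theory b)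
  ◇⇒Prec-S4×S5 ◇-trans ab χ (s , □χ) = s , λ u bu → □χ u (◇-trans ab bu)

  ◇⇒Prec-K4×S5 : Transitive◇ M → ∀ {a b} → a ⟶◇ b → Prec K4×S5 (theory a) (theory b)
  ◇⇒Prec-K4×S5 ◇-trans ab =
    ◇⇒Prec-S4×S5 ◇-trans ab , λ ψ (s , □ψ) → Sub-trans (in□ here) s , □ψ _ ab

  ◇⇒Prec-SSL : Transitive◇ M → Persistence M → ∀ {a b} → a ⟶◇ b → Prec SSL (theory a) (theory b)
  ◇⇒Prec-SSL ◇-trans persistence ab =
    ◇⇒Prec-S4×S5 ◇-trans ab , λ A → ⇔.refl ×-⇔ persistence ab A

  module _ (X : Logic) (◇⇒Prec : ∀ {a b} → a ⟶◇ b → Prec X (theory a) (theory b)) where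

    ◇⇒Back : ∀ {v u} → v ⟶◇ u → Back X (theoryCloud v) (theoryCloud u)
    ◇⇒Back vu G (u′ , uu′ , G≐) with leftComm vu uu′
    ... | v′ , vv′ , v′u′ =
      theory v′ , (v′ , vv′ , ≐-refl) , Prec-resp-≐ X ≐-refl (≐-sym G≐) (◇⇒Prec v′u′)

    ◇⇒Forth : RightComm M → ∀ {v u} → v ⟶◇ u → Forth X (theoryCloud v) (theoryCloud u)
    ◇⇒Forth rightComm vu F (v′ , vv′ , F≐) with rightComm (L-sym vv′) vu
    ... | u′ , v′u′ , u′u =
      theory u′ , (u′ , L-sym u′u , ≐-refl) , Prec-resp-≐ X F≐ ≐-refl (◇⇒Prec v′u′)

  ◇-counterexample : ∀ {v χ} → Sub (□ χ) φ → ¬ theory v (□ χ) → Σ[ u ∈ W ] (v ⟶◇ u × ¬ M , u ⊨ χ)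
  ◇-counterexample s □χ∉ =
    em⇒dne em λ none → □χ∉ (s , λ u vu → em⇒dne em λ ¬χ → none (u , vu , ¬χ))

  theoryTableau : (FSet AT → Set) → Set
  theoryTableau 𝓒 = Σ[ w ∈ W ] ∥ 𝓒 ≋ theoryCloud w ∥

  module _ (X : Logic)
           (reflT : ∀ v → BoxT X (theory v))
           (◇⇒Prec : ∀ {a b} → a ⟶◇ b → Prec X (theory a) (theory b))
           (◇⇒Leq : ∀ {v u} → v ⟶◇ u → Leq X (theoryCloud v) (theoryCloud u)) where

    theoryTableau-isPartialTableau : ∀ w₀ → IsPartialTableau₀ X φ (theoryCloud w₀) theoryTableau
    theoryTableau-isPartialTableau w₀ =
        (λ 𝓒 (w , 𝓒≋) → IsCloud-resp-≋ X φ (≋-sym (unresize 𝓒≋)) (theoryCloud-isCloud X reflT w))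
      , (w₀ , resize ≋-refl)
      , extend
      where
      extend : ∀ 𝓒 → theoryTableau 𝓒 → ∀ F → 𝓒 F → ∀ χ → Sub (□ χ) φ → ¬ F (□ χ) →
               Σ[ 𝓖 ∈ (FSet AT → Set) ] (theoryTableau 𝓖 × Leq X 𝓒 𝓖
                 × Σ[ G ∈ FSet AT ] (𝓖 G × Prec X F G × ¬ G χ))
      extend 𝓒 (w , 𝓒≋) F F∈𝓒 χ s □χ∉F with proj₁ (unresize 𝓒≋) F F∈𝓒
      ... | F′ , (v , wv , F′≐) , F≐F′ with ◇-counterexample s (□χ∉F ∘ from (≐-trans F≐F′ F′≐ (□ χ)))
      ... | u , vu , ¬χ =
          theoryCloud u , (u , resize ≋-refl)
        , Leq-resp-≋ X (≋-sym (≋-trans (unresize 𝓒≋) (theoryCloud-resp-L wv))) ≋-refl (◇⇒Leq vu)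
        , theory u , (u , L-refl u , ≐-refl) , Prec-resp-≐ X (≐-trans F≐F′ F′≐) ≐-refl (◇⇒Prec vu)
        , ¬χ ∘ proj₂

    satisfiable⇒hasPartialTableau : ∀ w₀ → M , w₀ ⊨ φ → HasPartialTableau X φ
    satisfiable⇒hasPartialTableau w₀ w₀⊨φ =
        theoryCloud w₀ , theoryCloud-isCloud X reflT w₀
      , theory w₀ , ((w₀ , L-refl w₀ , ≐-refl) , here , w₀⊨φ)
      , theoryTableau , theoryTableau-isPartialTableau w₀

model⇒tableau : Classical → ∀ {AT} X (φ : Formula AT) → Satisfiable X φ → HasPartialTableau X φ
model⇒tableau em K4×S5 φ (M , (◇-trans , L-equivalence , leftComm , rightComm) , w₀ , w₀⊨φ) =
  satisfiable⇒hasPartialTableau K4×S5 (λ _ → tt) ◇⇒Prec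
    (λ vu → ◇⇒Back K4×S5 ◇⇒Prec vu , ◇⇒Forth K4×S5 ◇⇒Prec rightComm vu) w₀ w₀⊨φ
  where
  open Model M using (_⟶◇_)
  open FromModel em φ M L-equivalence leftComm
  ◇⇒Prec : ∀ {a b} → a ⟶◇ b → Prec K4×S5 (theory a) (theory b)
  ◇⇒Prec = ◇⇒Prec-K4×S5 ◇-trans
model⇒tableau em S4×S5 φ (M , (◇-refl , ◇-trans , L-equivalence , leftComm , rightComm) , w₀ , w₀⊨φ) =
  satisfiable⇒hasPartialTableau S4×S5 (theory-unbox ◇-refl) ◇⇒Prec
    (λ vu → ◇⇒Back S4×S5 ◇⇒Prec vu , ◇⇒Forth S4×S5 ◇⇒Prec rightComm vu) w₀ w₀⊨φ
  where
  open Model M using (_⟶◇_)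
  open FromModel em φ M L-equivalence leftComm
  ◇⇒Prec : ∀ {a b} → a ⟶◇ b → Prec S4×S5 (theory a) (theory b)
  ◇⇒Prec = ◇⇒Prec-S4×S5 ◇-trans
model⇒tableau em SSL φ (M , (◇-refl , ◇-trans , L-equivalence , leftComm , persistence) , w₀ , w₀⊨φ) =
  satisfiable⇒hasPartialTableau SSL (theory-unbox ◇-refl) ◇⇒Prec (◇⇒Back SSL ◇⇒Prec) w₀ w₀⊨φ
  where
  open Model M using (_⟶◇_)
  open FromModel em φ M L-equivalence leftComm
  ◇⇒Prec : ∀ {a b} → a ⟶◇ b → Prec SSL (theory a) (theory b)
  ◇⇒Prec = ◇⇒Prec-SSL ◇-trans persistence

module Canonical (em : Classical) {AT : Set} (X : Logic) (φ : Formula AT)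
                 {𝓕₀ : FSet AT → Set} {𝔗 : (FSet AT → Set) → Set}
                 (tableau : IsPartialTableau₀ X φ 𝓕₀ 𝔗) where
  open Resizing em

  Code : Set
  Code = Formula AT → Bool

  CloudCode : Set
  CloudCode = Code → Bool

  decode : Code → FSet AT
  decode f ψ = T (f ψ)

  decodeCloud : CloudCode → FSet AT → Set
  decodeCloud c G = Σ[ g ∈ Code ] (T (c g) × G ≐ decode g)

  encode : FSet AT → Code
  encode G ψ = decide (G ψ)

  encodeCloud : (FSet AT → Set) → CloudCode
  encodeCloud 𝓖 g = decide (Σ[ G ∈ FSet AT ] (𝓖 G × G ≐ decode g))

  decode-encode : ∀ G → G ≐ decode (encode G)
  decode-encode G ψ = mk⇔ resize unresize

  decodeCloud-encodeCloud : ∀ 𝓖 → 𝓖 ≋ decodeCloud (encodeCloud 𝓖)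
  decodeCloud-encodeCloud 𝓖 =
      (λ G G∈𝓖 → G , (encode G , resize (G , G∈𝓖 , decode-encode G) , decode-encode G) , ≐-refl)
    , (λ G′ (g , g∈ , G′≐g) → let (G , G∈𝓖 , G≐g) = unresize g∈ in G , G∈𝓖 , ≐-trans G′≐g (≐-sym G≐g))

  decodeCloud-cong : ∀ {c c′} → (∀ g → c g ≡ c′ g) → decodeCloud c ≋ decodeCloud c′
  decodeCloud-cong c≗c′ =
      (λ G (g , g∈ , G≐g) → G , (g , subst T (c≗c′ g) g∈ , G≐g) , ≐-refl)
    , (λ G (g , g∈ , G≐g) → G , (g , subst T (sym (c≗c′ g)) g∈ , G≐g) , ≐-refl)

  IsPoint : Code → CloudCode → Set₁
  IsPoint f c = T (c f) × Σ[ 𝓕 ∈ (FSet AT → Set) ] (𝔗 𝓕 × 𝓕 ≋ decodeCloud c)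

  -- A world is a tableau-set lying in a cloud of 𝔗, both coded by Booleans so
  -- that the carrier of the model is small.
  record World : Set where
    field
      setCode   : Code
      cloudCode : CloudCode
      isPoint   : ∥ IsPoint setCode cloudCode ∥

    set : FSet AT
    set = decode setCode

    cloud : FSet AT → Set
    cloud = decodeCloud cloudCode

    point : IsPoint setCode cloudCode
    point = unresize isPoint

    set∈cloud : cloud set
    set∈cloud = setCode , proj₁ point , ≐-refl

    cloud-isCloud : IsCloud X φ cloud
    cloud-isCloud = let (𝓕 , 𝓕∈𝔗 , 𝓕≋) = proj₂ point in IsCloud-resp-≋ X φ 𝓕≋ (proj₁ tableau 𝓕 𝓕∈𝔗)

    set-isTableauSet : IsTableauSet X φ set
    set-isTableauSet = proj₁ cloud-isCloud set set∈cloud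

  open World

  memberWorld : (w : World) {g : Code} → T (cloudCode w g) → World
  memberWorld w {g} g∈ = record
    { setCode   = g
    ; cloudCode = cloudCode w
    ; isPoint   = resize (g∈ , proj₂ (point w))
    }

  tableauWorld : ∀ {𝓖 G} → 𝔗 𝓖 → 𝓖 G → World
  tableauWorld {𝓖} {G} 𝓖∈𝔗 G∈𝓖 = record
    { setCode   = encode G
    ; cloudCode = encodeCloud 𝓖
    ; isPoint   = resize (resize (G , G∈𝓖 , decode-encode G) , 𝓖 , 𝓖∈𝔗 , decodeCloud-encodeCloud 𝓖)
    }

  record _⟶L_ (w v : World) : Set where
    constructor mkL
    field
      sameCloud : ∀ g → cloudCode w g ≡ cloudCode v g

  open _⟶L_

  record _⟶◇_ (w v : World) : Set where
    constructor mk◇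
    field
      cloud≤ : ∥ Leq X (cloud w) (cloud v) ∥
      set≼   : Prec X (set w) (set v)

  open _⟶◇_

  M : Model AT
  M = record { W = World ; _⟶◇_ = _⟶◇_ ; _⟶L_ = _⟶L_ ; σ = λ A w → set w (atom A) }

  ◇⇒Leq : ∀ {w v} → w ⟶◇ v → Leq X (cloud w) (cloud v)
  ◇⇒Leq = unresize ∘ cloud≤

  set∈L-cloud : ∀ {w v} → w ⟶L v → cloud w (set v)
  set∈L-cloud {v = v} wv =
    setCode v , subst T (sym (sameCloud wv (setCode v))) (proj₁ (point v)) , ≐-refl

  L-sym : ∀ {w v} → w ⟶L v → v ⟶L w
  L-sym wv = mkL λ g → sym (sameCloud wv g)

  L-equivalence : EquivalenceL M
  L-equivalence =
    (λ w → mkL λ _ → refl) , L-sym , λ uv vw → mkL λ g → trans (sameCloud uv g) (sameCloud vw g)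

  ◇-transitive : Transitive◇ M
  ◇-transitive uv vw =
    mk◇ (resize (Leq-trans X (◇⇒Leq uv) (◇⇒Leq vw))) (Prec-trans X (set≼ uv) (set≼ vw))

  ◇-reflexive : (∀ F → Prec X F F) → Reflexive◇ M
  ◇-reflexive ≼-refl w = mk◇ (resize (Leq-refl X ≼-refl)) (≼-refl (set w))

  leftComm : LeftComm M
  leftComm {w} {u} {u′} wu uu′ with Leq⇒Back X (◇⇒Leq wu) (set u′) (set∈L-cloud uu′)
  ... | F , (g , g∈ , F≐g) , F≼u′ =
    memberWorld w g∈ , mkL (λ _ → refl) ,
    mk◇ (resize (Leq-resp-≋ X ≋-refl (decodeCloud-cong (sameCloud uu′)) (◇⇒Leq wu)))
        (Prec-resp-≐ X (≐-sym F≐g) ≐-refl F≼u′)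

  rightComm : (∀ {𝓕 𝓖} → Leq X 𝓕 𝓖 → Forth X 𝓕 𝓖) → RightComm M
  rightComm Leq⇒Forth {w} {w′} {u′} ww′ w′u′
    with Leq⇒Forth (◇⇒Leq w′u′) (set w) (set∈L-cloud (L-sym ww′))
  ... | G , (g , g∈ , G≐g) , w≼G =
    memberWorld u′ g∈ ,
    mk◇ (resize (Leq-resp-≋ X (decodeCloud-cong (sameCloud (L-sym ww′))) ≋-refl (◇⇒Leq w′u′)))
        (Prec-resp-≐ X ≐-refl G≐g w≼G) ,
    mkL (λ _ → refl)

  persistence : (∀ {F G} → Prec X F G → ∀ A → F (atom A) ⇔ G (atom A)) → Persistence M
  persistence Prec⇒atoms wv = Prec⇒atoms (set≼ wv)

  Truth : Formula AT → Set
  Truth ψ = ∀ w → set w ψ ⇔ M , w ⊨ ψ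

  truth-¬ : ∀ {χ} → Sub (¬' χ) φ → Truth χ → Truth (¬' χ)
  truth-¬ {χ} s truthχ w =
    let (_ , neg , _) = set-isTableauSet w in ⇔.trans (neg χ s) (¬-cong-⇔ (truthχ w))

  truth-∧ : ∀ {χ₁ χ₂} → Sub (χ₁ ∧' χ₂) φ → Truth χ₁ → Truth χ₂ → Truth (χ₁ ∧' χ₂)
  truth-∧ {χ₁} {χ₂} s truth₁ truth₂ w =
    let (_ , _ , conj , _) = set-isTableauSet w in ⇔.trans (conj χ₁ χ₂ s) (truth₁ w ×-⇔ truth₂ w)

  truth-K : ∀ {χ} → Sub (K χ) φ → Truth χ → Truth (K χ)
  truth-K {χ} s truthχ w with cloud-isCloud w
  ... | tableauSets , sameK , closedK = mk⇔ sound complete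
    where
    sound : set w (K χ) → M , w ⊨ K χ
    sound Kχ v wv =
      let v∈ = set∈L-cloud wv
          (_ , _ , _ , unK , _) = tableauSets (set v) v∈
      in to (truthχ v) (unK χ s (to (sameK _ _ (set∈cloud w) v∈ χ) Kχ))
    complete : M , w ⊨ K χ → set w (K χ)
    complete Kχ = closedK χ s χ∈cloud (set w) (set∈cloud w)
      where
      χ∈cloud : ∀ G → cloud w G → G χ
      χ∈cloud G (g , g∈ , G≐g) =
        from (G≐g χ) (from (truthχ (memberWorld w g∈)) (Kχ _ (mkL λ _ → refl)))

  -- The extension condition of the partial tableau, applied to the copy of
  -- set w in the cloud of 𝔗 underlying w, produces the refuting successor.
  truth-□ : ∀ {χ} → Sub (□ χ) φ → Truth χ → Truth (□ χ)
  truth-□ {χ} s truthχ w = mk⇔ sound complete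
    where
    sound : set w (□ χ) → M , w ⊨ □ χ
    sound □χ v wv =
      let (_ , _ , _ , _ , reflv) = set-isTableauSet v
      in to (truthχ v) (Prec-unbox X χ (set≼ wv) reflv □χ)
    complete : M , w ⊨ □ χ → set w (□ χ)
    complete □χ = em⇒dne em λ □χ∉w →
      let (_ , 𝓕 , 𝓕∈𝔗 , 𝓕≋) = point w
          (F , F∈𝓕 , w≐F) = proj₂ 𝓕≋ (set w) (set∈cloud w)
          (𝓖 , 𝓖∈𝔗 , 𝓕≤𝓖 , G , G∈𝓖 , F≼G , χ∉G) =
            proj₂ (proj₂ tableau) 𝓕 𝓕∈𝔗 F F∈𝓕 χ s (□χ∉w ∘ from (w≐F (□ χ)))
          u = tableauWorld 𝓖∈𝔗 G∈𝓖
          wu = mk◇ (resize (Leq-resp-≋ X 𝓕≋ (decodeCloud-encodeCloud 𝓖) 𝓕≤𝓖))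
                   (Prec-resp-≐ X w≐F (decode-encode G) F≼G)
      in χ∉G (from (decode-encode G χ) (from (truthχ u) (□χ u wu)))

  truth : ∀ ψ → Sub ψ φ → Truth ψ
  truth (atom A)   s w = ⇔.refl
  truth (¬' χ)     s   = truth-¬ s (truth χ (Sub-trans (in¬ here) s))
  truth (χ₁ ∧' χ₂) s   =
    truth-∧ s (truth χ₁ (Sub-trans (in∧ˡ here) s)) (truth χ₂ (Sub-trans (in∧ʳ here) s))
  truth (K χ)      s   = truth-K s (truth χ (Sub-trans (inK here) s))
  truth (□ χ)      s   = truth-□ s (truth χ (Sub-trans (in□ here) s))

canonical-isModel : (em : Classical) {AT : Set} (X : Logic) (φ : Formula AT) {𝓕₀ : FSet AT → Set}
                    {𝔗 : (FSet AT → Set) → Set} (tableau : IsPartialTableau₀ X φ 𝓕₀ 𝔗) →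
                    IsModel (Canonical.M em X φ tableau) X
canonical-isModel em K4×S5 φ tableau = ◇-transitive , L-equivalence , leftComm , rightComm proj₂
  where open Canonical em K4×S5 φ tableau
canonical-isModel em S4×S5 φ tableau =
  ◇-reflexive (λ F χ → id) , ◇-transitive , L-equivalence , leftComm , rightComm proj₂
  where open Canonical em S4×S5 φ tableau
canonical-isModel em SSL φ tableau =
  ◇-reflexive (λ F → (λ χ → id) , λ A → ⇔.refl) , ◇-transitive , L-equivalence , leftComm ,
  persistence proj₂
  where open Canonical em SSL φ tableau

tableau⇒model : Classical → ∀ {AT} X (φ : Formula AT) → HasPartialTableau X φ → Satisfiable X φ
tableau⇒model em X φ (_ , _ , F , (F∈𝓕₀ , φ∈F) , _ , tableau@(_ , 𝓕₀∈𝔗 , _)) =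
  M , canonical-isModel em X φ tableau , root , to (truth φ here root) (to (decode-encode F φ) φ∈F)
  where
  open Canonical em X φ tableau
  root : World
  root = tableauWorld 𝓕₀∈𝔗 F∈𝓕₀

proposition6p5 : Classical → {AT : Set} (X : Logic) (φ : Formula AT) →
    (Satisfiable X φ →
       Σ[ 𝓕₀ ∈ (FSet AT → Set) ] (IsCloud X φ 𝓕₀
         × Σ[ F ∈ FSet AT ] (𝓕₀ F × F φ)
         × Σ[ 𝔗 ∈ ((FSet AT → Set) → Set) ] IsPartialTableau₀ X φ 𝓕₀ 𝔗))
    × (Σ[ 𝓕₀ ∈ (FSet AT → Set) ] (IsCloud X φ 𝓕₀
         × Σ[ F ∈ FSet AT ] (𝓕₀ F × F φ)
         × Σ[ 𝔗 ∈ ((FSet AT → Set) → Set) ] IsPartialTableau₀ X φ 𝓕₀ 𝔗)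
       → Satisfiable X φ)
proposition6p5 em X φ = model⇒tableau em X φ , tableau⇒model em X φ
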